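{- Let $(f,C)$ be a low-defect pair of degree $r$ and let $n_1,\dots,n_r$ be nonnegative integers. Then: (1) $\delta(f(3^{n_1},\dots,3^{n_r}))\le\delta_{f,C}(n_1,\dots,n_r)$, and the difference $\delta_{f,C}(n_1,\dots,n_r)-\delta(f(3^{n_1},\dots,3^{n_r}))$ is an integer; (2) $\delta_{f,C}(n_1,\dots,n_r)\le\delta(f,C)$, and if $r\ge1$ this inequality is strict.
   Context: $\|n\|$ is the complexity of a positive integer $n$: the least number of $1$'s needed to write $n$ using $1$, $+$, $\times$ and parentheses; $\delta(n)=\|n\|-3\log_3 n$. For polynomials $f_1$ in $x_1,\dots,x_{r_1}$ and $f_2$ in $x_1,\dots,x_{r_2}$, $(f_1\otimes f_2)(x_1,\dots,x_{r_1+r_2})=f_1(x_1,\dots,x_{r_1})f_2(x_{r_1+1},\dots,x_{r_1+r_2})$. The set of low-defect pairs is the smallest subset $\mathscr{P}\subseteq\mathbb{Z}[x_1,x_2,\dots]\times\mathbb{N}$ such that: (i) for each positive integer constant $k$ and integer $C\ge\|k\|$, $(k,C)\in\mathscr{P}$; (ii) if $(f_1,C_1),(f_2,C_2)\in\mathscr{P}$ then $(f_1\otimes f_2,C_1+C_2)\in\mathscr{P}$; (iii) if $(f,C)\in\mathscr{P}$ with $f$ in $x_1,\dots,x_r$, $c$ a positive integer and $D\ge\|c\|$, then $(f(x_1,\dots,x_r)x_{r+1}+c,C+D)\in\mathscr{P}$. A pair of degree $r$ has $f$ in variables $x_1,\dots,x_r$; the coefficient $a$ of $x_1\cdots x_r$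 in $f$ is nonzero (the leading coefficient). Define $\delta(f,C)=C-3\log_3 a$ and $\delta_{f,C}(n_1,\dots,n_r)=C+3(n_1+\dots+n_r)-3\log_3 f(3^{n_1},\dots,3^{n_r})$. -}

module Defs where

open import Data.Nat as ℕ using (ℕ; zero; suc; _≤_)
open import Data.Integer as ℤ using (ℤ; +_)
open import Data.List using (List; []; _∷_; map; foldr)
open import Data.Fin using (Fin; zero; suc)
open import Data.Vec using (Vec; lookup)
open import Data.Product using (Σ; _×_)
open import Relation.Binary.PropositionalEquality using (_≡_)
open import Function using (_∘_)

data OneExpr : Set where
  one  : OneExpr
  _⊕_  : OneExpr → OneExpr → OneExpr
  _⊛_  : OneExpr → OneExpr → OneExpr

value : OneExpr → ℕ
value one = 1
value (e ⊕ e′) = value e ℕ.+ value e′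
value (e ⊛ e′) = value e ℕ.* value e′

ones : OneExpr → ℕ
ones one = 1
ones (e ⊕ e′) = ones e ℕ.+ ones e′
ones (e ⊛ e′) = ones e ℕ.+ ones e′

Complexity : ℕ → ℕ → Set
Complexity n c =
  Σ OneExpr (λ e → value e ≡ n × ones e ≡ c)
  × (∀ (e : OneExpr) → value e ≡ n → c ≤ ones e)

-- Poly (suc r): list of coefficients of x₁^0, x₁^1, …, each coefficient
-- being a polynomial in x₂,…,x_{r+1} (represented as Poly r, whose
-- variables are shifted by one).

Poly : ℕ → Set
Poly zero = ℤ
Poly (suc r) = List (Poly r)

-- evaluation; ρ i is the value of x_{i+1}
eval : ∀ {r} → Poly r → (Fin r → ℤ) → ℤ
eval {zero} k ρ = k
eval {suc r} cs ρ = foldr (λ c acc → eval c (ρ ∘ suc) ℤ.+ ρ zero ℤ.* acc) (+ 0) cs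

constP : ∀ {r} → ℤ → Poly r
constP {zero} k = k
constP {suc r} k = constP k ∷ []

addConst : ∀ {r} → ℤ → Poly r → Poly r
addConst {zero} c k = c ℤ.+ k
addConst {suc r} c [] = constP c ∷ []
addConst {suc r} c (p ∷ ps) = addConst c p ∷ ps

mulLast : ∀ {r} → Poly r → Poly (suc r)
mulLast {zero} k = + 0 ∷ k ∷ []
mulLast {suc r} cs = map mulLast cs

scale : ∀ {r} → ℤ → Poly r → Poly r
scale {zero} k p = k ℤ.* p
scale {suc r} k cs = map (scale k) cs

_⊗_ : ∀ {r₁ r₂} → Poly r₁ → Poly r₂ → Poly (r₁ ℕ.+ r₂)
_⊗_ {zero} k f₂ = scale k f₂
_⊗_ {suc r₁} cs f₂ = map (λ c → c ⊗ f₂) cs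

-- coefficient of x₁x₂⋯x_r
leadCoeff : ∀ {r} → Poly r → ℤ
leadCoeff {zero} k = k
leadCoeff {suc r} (_ ∷ p ∷ _) = leadCoeff p
leadCoeff {suc r} _ = + 0

data LowDefect : (r : ℕ) → Poly r → ℕ → Set where
  ld-const  : (k C c : ℕ) → 1 ≤ k → Complexity k c → c ≤ C →
              LowDefect 0 (+ k) C
  ld-tensor : ∀ {r₁ r₂ f₁ f₂ C₁ C₂} →
              LowDefect r₁ f₁ C₁ → LowDefect r₂ f₂ C₂ →
              LowDefect (r₁ ℕ.+ r₂) (f₁ ⊗ f₂) (C₁ ℕ.+ C₂)
  ld-step   : ∀ {r f C} → LowDefect r f C →
              (c D d : ℕ) → 1 ≤ c → Complexity c d → d ≤ D →
              LowDefect (suc r) (addConst (+ c) (mulLast f)) (C ℕ.+ D)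

pow3 : ∀ {r} → Vec ℕ r → Fin r → ℤ
pow3 ns i = + (3 ℕ.^ lookup ns i)

{-# OPTIONS --safe #-}
-- Read along its derivation, a low-defect polynomial evaluated at natural numbers is a natural
-- number built by the same rules: a constant k, a product of two such values, or c + v·x.
-- At x = 3^n the factor 3^n is written as ((1+1)+1)^n with 3n ones, so the derivation becomes an
-- expression with at most C + 3(n₁+⋯+n_r) ones, which gives (1). The leading coefficient
-- multiplies along ⊗ and is unchanged by the step rule, so a·3^{Σnᵢ} ≤ f(3^n) by induction;
-- the added constant c ≥ 1 makes each step strict, and strictness survives ⊗ because all
-- values are positive.
module Submission where

open import Defs
open import Data.Nat as ℕ using (ℕ; _≤_)
open import Data.Integer as ℤ using (ℤ; +_)
open import Data.Vec using (Vec; sum)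
open import Data.Product using (_×_)
open import Relation.Binary.PropositionalEquality using (_≡_)

open import Data.Nat using (zero; suc; _+_; _*_; _^_; _<_; z<s; >-nonZero)
open import Data.Nat.Properties
import Data.Integer.Properties as ℤₚ
open import Data.Fin using (Fin; zero; suc)
open import Data.List using ([]; _∷_)
open import Data.Vec using ([]; _∷_; lookup)
open import Data.Vec.Functional using (Vector; map; head; tail; take; drop; init; last)
open import Algebra.Properties.Monoid.Sum +-0-monoid using (sum-init-last) renaming (sum to ∑)
open import Data.Product using (Σ; _,_)
open import Relation.Binary.PropositionalEquality
  using (refl; sym; trans; cong; cong₂; subst; subst₂; module ≡-Reasoning)
import Data.Integer.Tactic.RingSolver as ℤ-Solver
open import Data.Nat.Tactic.RingSolver using (solve-∀)

eval-constP : ∀ {r} (k : ℤ) (ρ : Fin r → ℤ) → eval (constP {r} k) ρ ≡ k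
eval-constP {zero} k ρ = refl
eval-constP {suc r} k ρ =
  trans (cong₂ ℤ._+_ (eval-constP k (tail ρ)) (ℤₚ.*-zeroʳ (head ρ))) (ℤₚ.+-identityʳ k)

eval-addConst : ∀ {r} (c : ℤ) (p : Poly r) (ρ : Fin r → ℤ) →
                eval (addConst c p) ρ ≡ c ℤ.+ eval p ρ
eval-addConst {zero} c p ρ = refl
eval-addConst {suc r} c [] ρ =
  cong₂ ℤ._+_ (eval-constP c (tail ρ)) (ℤₚ.*-zeroʳ (head ρ))
eval-addConst {suc r} c (p ∷ ps) ρ =
  trans (cong (ℤ._+ head ρ ℤ.* eval ps ρ) (eval-addConst c p (tail ρ)))
        (ℤₚ.+-assoc c (eval p (tail ρ)) (head ρ ℤ.* eval ps ρ))

eval-scale : ∀ {r} (k : ℤ) (f : Poly r) (ρ : Fin r → ℤ) →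
             eval (scale k f) ρ ≡ k ℤ.* eval f ρ
eval-scale {zero} k f ρ = refl
eval-scale {suc r} k [] ρ = sym (ℤₚ.*-zeroʳ k)
eval-scale {suc r} k (c ∷ cs) ρ =
  trans (cong₂ (λ u v → u ℤ.+ head ρ ℤ.* v) (eval-scale k c (tail ρ)) (eval-scale k cs ρ))
        (factorˡ k (eval c (tail ρ)) (head ρ) (eval cs ρ))
  where
  factorˡ : ∀ k a x b → k ℤ.* a ℤ.+ x ℤ.* (k ℤ.* b) ≡ k ℤ.* (a ℤ.+ x ℤ.* b)
  factorˡ = ℤ-Solver.solve-∀

eval-⊗ : ∀ {r₁ r₂} (f₁ : Poly r₁) (f₂ : Poly r₂) (ρ : Fin (r₁ ℕ.+ r₂) → ℤ) →
         eval (f₁ ⊗ f₂) ρ ≡ eval f₁ (take r₁ ρ) ℤ.* eval f₂ (drop r₁ ρ)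
eval-⊗ {zero} k f₂ ρ = eval-scale k f₂ ρ
eval-⊗ {suc r₁} [] f₂ ρ = refl
eval-⊗ {suc r₁} (c ∷ cs) f₂ ρ =
  trans (cong₂ (λ u v → u ℤ.+ head ρ ℤ.* v) (eval-⊗ c f₂ (tail ρ)) (eval-⊗ cs f₂ ρ))
        (factorʳ (eval c (tail (take (suc r₁) ρ))) (eval f₂ (drop (suc r₁) ρ))
                 (head ρ) (eval cs (take (suc r₁) ρ)))
  where
  factorʳ : ∀ a y x b → a ℤ.* y ℤ.+ x ℤ.* (b ℤ.* y) ≡ (a ℤ.+ x ℤ.* b) ℤ.* y
  factorʳ = ℤ-Solver.solve-∀

eval-mulLast : ∀ {r} (f : Poly r) (ρ : Fin (suc r) → ℤ) →
               eval (mulLast f) ρ ≡ eval f (init ρ) ℤ.* last ρ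
eval-mulLast {zero} k ρ = linear (head ρ) k
  where
  linear : ∀ x k → + 0 ℤ.+ x ℤ.* (k ℤ.+ x ℤ.* + 0) ≡ k ℤ.* x
  linear = ℤ-Solver.solve-∀
eval-mulLast {suc r} [] ρ = refl
eval-mulLast {suc r} (c ∷ cs) ρ =
  trans (cong₂ (λ u v → u ℤ.+ head ρ ℤ.* v) (eval-mulLast c (tail ρ)) (eval-mulLast cs ρ))
        (factorʳ (eval c (tail (init ρ))) (last ρ) (head ρ) (eval cs (init ρ)))
  where
  factorʳ : ∀ a y x b → a ℤ.* y ℤ.+ x ℤ.* (b ℤ.* y) ≡ (a ℤ.+ x ℤ.* b) ℤ.* y
  factorʳ = ℤ-Solver.solve-∀

leadCoeff-scale : ∀ {r} (k : ℤ) (f : Poly r) → leadCoeff (scale k f) ≡ k ℤ.* leadCoeff f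
leadCoeff-scale {zero} k f = refl
leadCoeff-scale {suc r} k [] = sym (ℤₚ.*-zeroʳ k)
leadCoeff-scale {suc r} k (_ ∷ []) = sym (ℤₚ.*-zeroʳ k)
leadCoeff-scale {suc r} k (_ ∷ p ∷ _) = leadCoeff-scale k p

leadCoeff-⊗ : ∀ {r₁ r₂} (f₁ : Poly r₁) (f₂ : Poly r₂) →
              leadCoeff (f₁ ⊗ f₂) ≡ leadCoeff f₁ ℤ.* leadCoeff f₂
leadCoeff-⊗ {zero} k f₂ = leadCoeff-scale k f₂
leadCoeff-⊗ {suc r₁} [] f₂ = refl
leadCoeff-⊗ {suc r₁} (_ ∷ []) f₂ = refl
leadCoeff-⊗ {suc r₁} (_ ∷ p ∷ _) f₂ = leadCoeff-⊗ p f₂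

leadCoeff-mulLast : ∀ {r} (f : Poly r) → leadCoeff (mulLast f) ≡ leadCoeff f
leadCoeff-mulLast {zero} k = refl
leadCoeff-mulLast {suc r} [] = refl
leadCoeff-mulLast {suc r} (_ ∷ []) = refl
leadCoeff-mulLast {suc r} (_ ∷ p ∷ _) = leadCoeff-mulLast p

leadCoeff-addConst-mulLast : ∀ {r} (c : ℤ) (f : Poly r) →
                             leadCoeff (addConst c (mulLast f)) ≡ leadCoeff f
leadCoeff-addConst-mulLast {zero} c k = refl
leadCoeff-addConst-mulLast {suc r} c [] = refl
leadCoeff-addConst-mulLast {suc r} c (_ ∷ []) = refl
leadCoeff-addConst-mulLast {suc r} c (_ ∷ p ∷ _) = leadCoeff-mulLast p

evalℕ : ∀ {r f C} → LowDefect r f C → Vector ℕ r → ℕ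
evalℕ (ld-const k _ _ _ _ _) ρ = k
evalℕ (ld-tensor {r₁} d₁ d₂) ρ = evalℕ d₁ (take r₁ ρ) * evalℕ d₂ (drop r₁ ρ)
evalℕ (ld-step d c _ _ _ _ _) ρ = c + evalℕ d (init ρ) * last ρ

leadℕ : ∀ {r f C} → LowDefect r f C → ℕ
leadℕ (ld-const k _ _ _ _ _) = k
leadℕ (ld-tensor d₁ d₂) = leadℕ d₁ * leadℕ d₂
leadℕ (ld-step d _ _ _ _ _ _) = leadℕ d

eval≡evalℕ : ∀ {r f C} (d : LowDefect r f C) (ρ : Vector ℕ r) →
             eval f (map +_ ρ) ≡ + evalℕ d ρ
eval≡evalℕ (ld-const _ _ _ _ _ _) ρ = refl
eval≡evalℕ (ld-tensor {r₁} {f₁ = f₁} {f₂} d₁ d₂) ρ = begin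
  eval (f₁ ⊗ f₂) (map +_ ρ)
    ≡⟨ eval-⊗ f₁ f₂ (map +_ ρ) ⟩
  eval f₁ (map +_ ρ₁) ℤ.* eval f₂ (map +_ ρ₂)
    ≡⟨ cong₂ ℤ._*_ (eval≡evalℕ d₁ ρ₁) (eval≡evalℕ d₂ ρ₂) ⟩
  + evalℕ d₁ ρ₁ ℤ.* + evalℕ d₂ ρ₂
    ≡⟨ ℤₚ.pos-* (evalℕ d₁ ρ₁) (evalℕ d₂ ρ₂) ⟨
  + (evalℕ d₁ ρ₁ * evalℕ d₂ ρ₂)
    ∎
  where
  open ≡-Reasoning
  ρ₁ = take r₁ ρ
  ρ₂ = drop r₁ ρ
eval≡evalℕ (ld-step {f = f} d c _ _ _ _ _) ρ = begin
  eval (addConst (+ c) (mulLast f)) (map +_ ρ)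
    ≡⟨ eval-addConst (+ c) (mulLast f) (map +_ ρ) ⟩
  + c ℤ.+ eval (mulLast f) (map +_ ρ)
    ≡⟨ cong (ℤ._+_ (+ c)) (eval-mulLast f (map +_ ρ)) ⟩
  + c ℤ.+ eval f (map +_ (init ρ)) ℤ.* + last ρ
    ≡⟨ cong (λ v → + c ℤ.+ v ℤ.* + last ρ) (eval≡evalℕ d (init ρ)) ⟩
  + c ℤ.+ + v ℤ.* + last ρ
    ≡⟨ cong (ℤ._+_ (+ c)) (ℤₚ.pos-* v (last ρ)) ⟨
  + c ℤ.+ + (v * last ρ)
    ≡⟨ ℤₚ.pos-+ c (v * last ρ) ⟨
  + (c + v * last ρ)
    ∎
  where
  open ≡-Reasoning
  v = evalℕ d (init ρ)

leadCoeff≡leadℕ : ∀ {r f C} (d : LowDefect r f C) → leadCoeff f ≡ + leadℕ d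
leadCoeff≡leadℕ (ld-const _ _ _ _ _ _) = refl
leadCoeff≡leadℕ (ld-tensor {f₁ = f₁} {f₂} d₁ d₂) =
  trans (leadCoeff-⊗ f₁ f₂)
        (trans (cong₂ ℤ._*_ (leadCoeff≡leadℕ d₁) (leadCoeff≡leadℕ d₂))
               (sym (ℤₚ.pos-* (leadℕ d₁) (leadℕ d₂))))
leadCoeff≡leadℕ (ld-step {f = f} d c _ _ _ _ _) =
  trans (leadCoeff-addConst-mulLast (+ c) f) (leadCoeff≡leadℕ d)

evalℕ-positive : ∀ {r f C} (d : LowDefect r f C) (ρ : Vector ℕ r) → 0 < evalℕ d ρ
evalℕ-positive (ld-const _ _ _ 1≤k _ _) ρ = 1≤k
evalℕ-positive (ld-tensor d₁ d₂) ρ = *-mono-≤ (evalℕ-positive d₁ _) (evalℕ-positive d₂ _)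
evalℕ-positive (ld-step _ c _ _ 1≤c _ _) ρ = ≤-trans 1≤c (m≤m+n c _)

∑-take-drop : ∀ m {n} (e : Vector ℕ (m ℕ.+ n)) → ∑ e ≡ ∑ (take m e) + ∑ (drop m e)
∑-take-drop zero e = refl
∑-take-drop (suc m) e =
  trans (cong (_+_ (head e)) (∑-take-drop m (tail e)))
        (sym (+-assoc (head e) (∑ (take m (tail e))) (∑ (drop m (tail e)))))

sum≡∑-lookup : ∀ {r} (ns : Vec ℕ r) → sum ns ≡ ∑ (lookup ns)
sum≡∑-lookup [] = refl
sum≡∑-lookup (n ∷ ns) = cong (_+_ n) (sum≡∑-lookup ns)

Expressible : ℕ → ℕ → Set
Expressible n k = Σ OneExpr λ e → value e ≡ n × ones e ≤ k

complexity≤ : ∀ {n c k} → Complexity n c → Expressible n k → c ≤ k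
complexity≤ (_ , minimal) (e , refl , e≤k) = ≤-trans (minimal e refl) e≤k

complexity⇒expressible : ∀ {n c k} → Complexity n c → c ≤ k → Expressible n k
complexity⇒expressible ((e , e≡n , ones≡c) , _) c≤k = e , e≡n , ≤-trans (≤-reflexive ones≡c) c≤k

expressible-+ : ∀ {m n k l} → Expressible m k → Expressible n l → Expressible (m + n) (k + l)
expressible-+ (e , refl , e≤k) (e′ , refl , e′≤l) = e ⊕ e′ , refl , +-mono-≤ e≤k e′≤l

expressible-* : ∀ {m n k l} → Expressible m k → Expressible n l → Expressible (m * n) (k + l)
expressible-* (e , refl , e≤k) (e′ , refl , e′≤l) = e ⊛ e′ , refl , +-mono-≤ e≤k e′≤l

expressible-3 : Expressible 3 3
expressible-3 = (one ⊕ one) ⊕ one , refl , ≤-refl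

expressible-*3^ : ∀ {m k} → Expressible m k → ∀ n → Expressible (m * 3 ^ n) (k + 3 * n)
expressible-*3^ {m} {k} x zero = subst₂ Expressible (sym (*-identityʳ m)) (sym (+-identityʳ k)) x
expressible-*3^ {m} {k} x (suc n) =
  subst₂ Expressible (reassoc m (3 ^ n)) (regroup k n) (expressible-* (expressible-*3^ x n) expressible-3)
  where
  reassoc : ∀ m p → m * p * 3 ≡ m * (3 * p)
  reassoc = solve-∀
  regroup : ∀ k n → k + 3 * n + 3 ≡ k + 3 * suc n
  regroup = solve-∀

evalℕ-expressible : ∀ {r f C} (d : LowDefect r f C) (e : Vector ℕ r) →
                    Expressible (evalℕ d (map (3 ^_) e)) (C + 3 * ∑ e)
evalℕ-expressible (ld-const _ C _ _ ‖k‖≡c c≤C) e =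
  complexity⇒expressible ‖k‖≡c (≤-trans c≤C (m≤m+n C 0))
evalℕ-expressible (ld-tensor {r₁} {C₁ = C₁} {C₂} d₁ d₂) e =
  subst (Expressible _) bound
    (expressible-* (evalℕ-expressible d₁ (take r₁ e)) (evalℕ-expressible d₂ (drop r₁ e)))
  where
  regroup : ∀ C₁ C₂ s₁ s₂ → C₁ + 3 * s₁ + (C₂ + 3 * s₂) ≡ C₁ + C₂ + 3 * (s₁ + s₂)
  regroup = solve-∀
  bound : C₁ + 3 * ∑ (take r₁ e) + (C₂ + 3 * ∑ (drop r₁ e)) ≡ C₁ + C₂ + 3 * ∑ e
  bound = trans (regroup C₁ C₂ (∑ (take r₁ e)) (∑ (drop r₁ e)))
                (cong (λ s → C₁ + C₂ + 3 * s) (sym (∑-take-drop r₁ e)))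
evalℕ-expressible (ld-step {C = C} d _ D _ _ ‖c‖≡c′ c′≤D) e =
  subst (Expressible _) bound
    (expressible-+ (complexity⇒expressible ‖c‖≡c′ c′≤D)
                   (expressible-*3^ (evalℕ-expressible d (init e)) (last e)))
  where
  regroup : ∀ C D s n → D + (C + 3 * s + 3 * n) ≡ C + D + 3 * (s + n)
  regroup = solve-∀
  bound : D + (C + 3 * ∑ (init e) + 3 * last e) ≡ C + D + 3 * ∑ e
  bound = trans (regroup C D (∑ (init e)) (last e))
                (cong (λ s → C + D + 3 * s) (sym (sum-init-last e)))

*-mono-<-≤ : ∀ {m n o p} → m < n → o ≤ p → 0 < p → m * o < n * p
*-mono-<-≤ {m} {n} {o} {p} m<n o≤p 0<p = begin-strict
  m * o  ≤⟨ *-monoʳ-≤ m o≤p ⟩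
  m * p  <⟨ *-monoˡ-< p {{>-nonZero 0<p}} m<n ⟩
  n * p  ∎
  where open ≤-Reasoning

*-mono-≤-< : ∀ {m n o p} → m ≤ n → o < p → 0 < n → m * o < n * p
*-mono-≤-< {m} {n} {o} {p} m≤n o<p 0<n = begin-strict
  m * o  ≤⟨ *-monoˡ-≤ o m≤n ⟩
  n * o  <⟨ *-monoʳ-< n {{>-nonZero 0<n}} o<p ⟩
  n * p  ∎
  where open ≤-Reasoning

*-3^∑-take-drop : ∀ a b m {n} (e : Vector ℕ (m ℕ.+ n)) →
                  a * b * 3 ^ ∑ e ≡ (a * 3 ^ ∑ (take m e)) * (b * 3 ^ ∑ (drop m e))
*-3^∑-take-drop a b m e = begin
  a * b * 3 ^ ∑ e                  ≡⟨ cong (λ s → a * b * 3 ^ s) (∑-take-drop m e) ⟩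
  a * b * 3 ^ (s₁ + s₂)            ≡⟨ cong (a * b *_) (^-distribˡ-+-* 3 s₁ s₂) ⟩
  a * b * (3 ^ s₁ * 3 ^ s₂)        ≡⟨ interchange a b (3 ^ s₁) (3 ^ s₂) ⟩
  (a * 3 ^ s₁) * (b * 3 ^ s₂)      ∎
  where
  open ≡-Reasoning
  s₁ = ∑ (take m e)
  s₂ = ∑ (drop m e)
  interchange : ∀ a b x y → a * b * (x * y) ≡ (a * x) * (b * y)
  interchange = solve-∀

*-3^∑-init-last : ∀ a {n} (e : Vector ℕ (suc n)) →
                  a * 3 ^ ∑ e ≡ a * 3 ^ ∑ (init e) * 3 ^ last e
*-3^∑-init-last a e = begin
  a * 3 ^ ∑ e                          ≡⟨ cong (λ s → a * 3 ^ s) (sum-init-last e) ⟩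
  a * 3 ^ (∑ (init e) + last e)        ≡⟨ cong (a *_) (^-distribˡ-+-* 3 (∑ (init e)) (last e)) ⟩
  a * (3 ^ ∑ (init e) * 3 ^ last e)    ≡⟨ *-assoc a (3 ^ ∑ (init e)) (3 ^ last e) ⟨
  a * 3 ^ ∑ (init e) * 3 ^ last e      ∎
  where open ≡-Reasoning

lead*3^∑≤evalℕ : ∀ {r f C} (d : LowDefect r f C) (e : Vector ℕ r) →
                 leadℕ d * 3 ^ ∑ e ≤ evalℕ d (map (3 ^_) e)
lead*3^∑<evalℕ : ∀ {r f C} (d : LowDefect r f C) (e : Vector ℕ r) → 0 < r →
                 leadℕ d * 3 ^ ∑ e < evalℕ d (map (3 ^_) e)

lead*3^∑≤evalℕ (ld-const k _ _ _ _ _) e = ≤-reflexive (*-identityʳ k)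
lead*3^∑≤evalℕ (ld-tensor {r₁} d₁ d₂) e = begin
  leadℕ d₁ * leadℕ d₂ * 3 ^ ∑ e
    ≡⟨ *-3^∑-take-drop (leadℕ d₁) (leadℕ d₂) r₁ e ⟩
  (leadℕ d₁ * 3 ^ ∑ (take r₁ e)) * (leadℕ d₂ * 3 ^ ∑ (drop r₁ e))
    ≤⟨ *-mono-≤ (lead*3^∑≤evalℕ d₁ (take r₁ e)) (lead*3^∑≤evalℕ d₂ (drop r₁ e)) ⟩
  evalℕ d₁ (map (3 ^_) (take r₁ e)) * evalℕ d₂ (map (3 ^_) (drop r₁ e))
    ∎
  where open ≤-Reasoning
lead*3^∑≤evalℕ d@(ld-step _ _ _ _ _ _ _) e = <⇒≤ (lead*3^∑<evalℕ d e z<s)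

lead*3^∑<evalℕ (ld-const _ _ _ _ _ _) e ()
lead*3^∑<evalℕ (ld-tensor {zero} d₁ d₂) e 0<r₂ = begin-strict
  leadℕ d₁ * leadℕ d₂ * 3 ^ ∑ e
    ≡⟨ *-3^∑-take-drop (leadℕ d₁) (leadℕ d₂) 0 e ⟩
  (leadℕ d₁ * 3 ^ ∑ (take 0 e)) * (leadℕ d₂ * 3 ^ ∑ (drop 0 e))
    <⟨ *-mono-≤-< (lead*3^∑≤evalℕ d₁ (take 0 e)) (lead*3^∑<evalℕ d₂ (drop 0 e) 0<r₂)
                  (evalℕ-positive d₁ (map (3 ^_) (take 0 e))) ⟩
  evalℕ d₁ (map (3 ^_) (take 0 e)) * evalℕ d₂ (map (3 ^_) (drop 0 e))
    ∎
  where open ≤-Reasoning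
lead*3^∑<evalℕ (ld-tensor {suc r₁} d₁ d₂) e _ = begin-strict
  leadℕ d₁ * leadℕ d₂ * 3 ^ ∑ e
    ≡⟨ *-3^∑-take-drop (leadℕ d₁) (leadℕ d₂) (suc r₁) e ⟩
  (leadℕ d₁ * 3 ^ ∑ (take (suc r₁) e)) * (leadℕ d₂ * 3 ^ ∑ (drop (suc r₁) e))
    <⟨ *-mono-<-≤ (lead*3^∑<evalℕ d₁ (take (suc r₁) e) z<s) (lead*3^∑≤evalℕ d₂ (drop (suc r₁) e))
                  (evalℕ-positive d₂ (map (3 ^_) (drop (suc r₁) e))) ⟩
  evalℕ d₁ (map (3 ^_) (take (suc r₁) e)) * evalℕ d₂ (map (3 ^_) (drop (suc r₁) e))
    ∎
  where open ≤-Reasoning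
lead*3^∑<evalℕ (ld-step d c _ _ 0<c _ _) e _ = begin-strict
  leadℕ d * 3 ^ ∑ e                                  ≡⟨ *-3^∑-init-last (leadℕ d) e ⟩
  leadℕ d * 3 ^ ∑ (init e) * 3 ^ last e              ≤⟨ *-monoˡ-≤ (3 ^ last e) (lead*3^∑≤evalℕ d (init e)) ⟩
  evalℕ d (map (3 ^_) (init e)) * 3 ^ last e         <⟨ m<n+m _ 0<c ⟩
  c + evalℕ d (map (3 ^_) (init e)) * 3 ^ last e     ∎
  where open ≤-Reasoning

proposition4p9 : ∀ (r : ℕ) (f : Poly r) (C : ℕ) → LowDefect r f C →
    (ns : Vec ℕ r) →
    -- f(3^n) is a positive integer (so δ(f(3^n)) is defined)
    (+ 0 ℤ.< eval f (pow3 ns))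
    -- (1)  δ(f(3^n)) ≤ δ_{f,C}(n), i.e. ‖f(3^n)‖ ≤ C + 3(n₁+⋯+n_r)
    × (∀ (m c : ℕ) → eval f (pow3 ns) ≡ + m → Complexity m c →
         c ≤ C ℕ.+ 3 ℕ.* sum ns)
    -- (2)  δ_{f,C}(n) ≤ δ(f,C), i.e. a·3^{n₁+⋯+n_r} ≤ f(3^n) (a = leading coeff.)
    × (leadCoeff f ℤ.* + (3 ℕ.^ sum ns) ℤ.≤ eval f (pow3 ns))
    -- … strictly if r ≥ 1
    × (1 ≤ r → leadCoeff f ℤ.* + (3 ℕ.^ sum ns) ℤ.< eval f (pow3 ns))
proposition4p9 r f C d ns =
    subst (ℤ._<_ (+ 0)) (sym eval≡) (ℤ.+<+ (evalℕ-positive d (map (3 ^_) e)))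
  , (λ _ _ f≡m ‖m‖≡c → complexity≤ ‖m‖≡c (subst₂ Expressible (m≡ f≡m) ones≡ (evalℕ-expressible d e)))
  , subst₂ ℤ._≤_ (sym lead≡) (sym eval≡) (ℤ.+≤+ (lead*3^∑≤evalℕ d e))
  , λ 0<r → subst₂ ℤ._<_ (sym lead≡) (sym eval≡) (ℤ.+<+ (lead*3^∑<evalℕ d e 0<r))
  where
  e = lookup ns
  eval≡ : eval f (pow3 ns) ≡ + evalℕ d (map (3 ^_) e)
  eval≡ = eval≡evalℕ d (map (3 ^_) e)
  m≡ : ∀ {m} → eval f (pow3 ns) ≡ + m → evalℕ d (map (3 ^_) e) ≡ m
  m≡ f≡m = ℤₚ.+-injective (trans (sym eval≡) f≡m)
  ones≡ : C + 3 * ∑ e ≡ C + 3 * sum ns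
  ones≡ = cong (λ s → C + 3 * s) (sym (sum≡∑-lookup ns))
  lead≡ : leadCoeff f ℤ.* + (3 ^ sum ns) ≡ + (leadℕ d * 3 ^ ∑ e)
  lead≡ = trans (cong₂ (λ a s → a ℤ.* + (3 ^ s)) (leadCoeff≡leadℕ d) (sum≡∑-lookup ns))
               (sym (ℤₚ.pos-* (leadℕ d) (3 ^ ∑ e)))
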